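{- Let $R$ be a commutative ring with $1$ and $\mathfrak G$ the matroid of a hyperplane arrangement on $[n]$. Suppose $\Gamma'$ and $\Gamma$ are graphs with vertex set $[n]$ such that every edge of $\Gamma'$ is an edge of $\Gamma$ and $\mathcal X_{\Gamma'}(\mathfrak G)\subseteq\mathcal X_\Gamma(\mathfrak G)$. Then $V^1(\Gamma,R)\subseteq V^1(\Gamma',R)$.
   Context: Let $\mathcal A=\{H_1,\dots,H_n\}$ be an arrangement of distinct linear hyperplanes in $\mathbb C^\ell$ and $\mathfrak G$ its matroid on $[n]$. A line of $\mathfrak G$ is a set $X=\{k: H_k\supseteq H_i\cap H_j\}$ for some $i\ne j$; $\mathcal X_0(\mathfrak G)$ is the set of lines with $|X|\ge3$. For $\xi\in R^n$ and $S\subseteq[n]$, $\boldsymbol\xi_S=(\xi_i)_{i\in S}$ and $\xi_S=\sum_{i\in S}\xi_i$. Vectors $\xi,\nu$ are parallel if all $\xi_i\nu_j-\xi_j\nu_i=0$. Convention: $s\in R$ is a zero divisor if $rs=0$ for some $r\neq0$. For a graph $\Gamma$ on $[n]$ (a clique being a set of pairwise adjacent vertices): $\mathcal X_\Gamma(\mathfrak G)=\{X\in\mathcal X_0(\mathfrak G):X\text{ not a clique of }\Gamma\}$; $K(\Gamma,R)=\{\xi\in R^n:\xi_X\text{ is a zero divisor for all }X\in\mathcal X_\Gamma(\mathfrak G)\}$; for $\lambda\in K(\Gamma,R)$, $Z_\Gamma(\lambda)$ is the set of $\eta\in K(\Gamma,R)$ with (i) $\lambda_X\boldsymbol\eta_X=\eta_X\boldsymbol\lambda_X$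 for all $X\in\mathcal X_\Gamma(\mathfrak G)$ and (ii) $\lambda_i\eta_j-\lambda_j\eta_i=0$ for every edge $\{i,j\}$ of $\Gamma$; and $V^1(\Gamma,R)=\{\lambda\in K(\Gamma,R):\exists\,\eta\in Z_\Gamma(\lambda)\text{ not parallel to }\lambda\}$. -}

module Defs where

open import Level using (Level; _⊔_; suc)
open import Algebra.Bundles using (CommutativeRing)
open import Data.Bool using (Bool; true; false; if_then_else_)
open import Data.Nat using (ℕ; _≥_)
open import Data.Fin using (Fin)
open import Data.Fin.Subset using (Subset; _∈_; ∣_∣)
open import Data.Vec using (tabulate; lookup)
import Data.Vec.Functional as VF
open import Data.Product using (Σ; ∃; _×_)
open import Relation.Nullary using (¬_)
open import Relation.Binary.PropositionalEquality using (_≡_; _≢_)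

-- The matroid 𝔊 of an arrangement {H_1,…,H_n}, given through the relation
-- Contains i j k  ⇔  H_k ⊇ H_i ∩ H_j  (Boolean-valued, i.e. decided).
record ArrMatroid (n : ℕ) : Set where
  field
    Contains : Fin n → Fin n → Fin n → Bool

line : ∀ {n} → ArrMatroid n → Fin n → Fin n → Subset n
line G i j = tabulate (ArrMatroid.Contains G i j)

IsLine : ∀ {n} → ArrMatroid n → Subset n → Set
IsLine G X = Σ _ λ i → Σ _ λ j → (i ≢ j) × (X ≡ line G i j)

𝒳₀ : ∀ {n} → ArrMatroid n → Subset n → Set
𝒳₀ G X = IsLine G X × (∣ X ∣ ≥ 3)

record Graph (n : ℕ) : Set₁ where
  field
    Adj   : Fin n → Fin n → Set
    sym   : ∀ {i j} → Adj i j → Adj j i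
    irrefl : ∀ {i} → ¬ Adj i i

open Graph public

IsClique : ∀ {n} → Graph n → Subset n → Set
IsClique Γ X = ∀ i j → i ∈ X → j ∈ X → i ≢ j → Adj Γ i j

𝒳 : ∀ {n} → Graph n → ArrMatroid n → Subset n → Set
𝒳 Γ G X = 𝒳₀ G X × ¬ IsClique Γ X

_⊆ᴱ_ : ∀ {n} → Graph n → Graph n → Set
Γ' ⊆ᴱ Γ = ∀ i j → Adj Γ' i j → Adj Γ i j

module _ {c ℓ : Level} (R : CommutativeRing c ℓ) where
  open CommutativeRing R renaming (Carrier to A)

  Vecᴿ : ℕ → Set c
  Vecᴿ n = Fin n → A

  ZeroDivisor : A → Set (c ⊔ ℓ)
  ZeroDivisor s = ∃ λ r → (¬ r ≈ 0#) × (r * s ≈ 0#)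

  sumOver : ∀ {n} → Subset n → Vecᴿ n → A
  sumOver X ξ = VF.foldr _+_ 0# (λ k → if lookup X k then ξ k else 0#)

  Parallel : ∀ {n} → Vecᴿ n → Vecᴿ n → Set ℓ
  Parallel ξ ν = ∀ i j → ξ i * ν j - ξ j * ν i ≈ 0#

  K : ∀ {n} → Graph n → ArrMatroid n → Vecᴿ n → Set (c ⊔ ℓ)
  K Γ G ξ = ∀ X → 𝒳 Γ G X → ZeroDivisor (sumOver X ξ)

  InZ : ∀ {n} → Graph n → ArrMatroid n → Vecᴿ n → Vecᴿ n → Set (c ⊔ ℓ)
  InZ Γ G λ' η =
    K Γ G η
    × (∀ X → 𝒳 Γ G X → ∀ k → k ∈ X → sumOver X λ' * η k ≈ sumOver X η * λ' k)
    × (∀ i j → Adj Γ i j → λ' i * η j - λ' j * η i ≈ 0#)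

  V¹ : ∀ {n} → Graph n → ArrMatroid n → Vecᴿ n → Set (c ⊔ ℓ)
  V¹ Γ G λ' = K Γ G λ' × ∃ λ η → InZ Γ G λ' η × ¬ Parallel λ' η

{-# OPTIONS --safe #-}
module Submission where

open import Defs
open import Level using (Level)
open import Algebra.Bundles using (CommutativeRing)
open import Data.Nat using (ℕ)
open import Data.Fin.Subset using (Subset)
open import Data.Product using (_,_)

-- Every condition defining K, Z and V¹ is quantified over 𝒳_Γ(𝔊) or over the
-- edges of Γ, so it only weakens when both shrink; non-parallelism does not
-- involve Γ at all, and the same witness η works for Γ'.

module _ {c ℓ : Level} (R : CommutativeRing c ℓ) {n : ℕ} (G : ArrMatroid n)
         (Γ' Γ : Graph n) (𝒳-⊆ : ∀ (X : Subset n) → 𝒳 Γ' G X → 𝒳 Γ G X) where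

  K-antitone : ∀ {ξ : Vecᴿ R n} → K R Γ G ξ → K R Γ' G ξ
  K-antitone kξ X X∈𝒳' = kξ X (𝒳-⊆ X X∈𝒳')

  InZ-antitone : Γ' ⊆ᴱ Γ → ∀ {λ' η : Vecᴿ R n} → InZ R Γ G λ' η → InZ R Γ' G λ' η
  InZ-antitone E-⊆ (kη , lines , edges) =
    K-antitone kη , (λ X X∈𝒳' → lines X (𝒳-⊆ X X∈𝒳')) , (λ i j ij∈E' → edges i j (E-⊆ i j ij∈E'))

theorem3p14 : ∀ {c ℓ : Level} (R : CommutativeRing c ℓ) {n : ℕ}
    (G : ArrMatroid n) (Γ' Γ : Graph n) →
    Γ' ⊆ᴱ Γ →
    (∀ (X : Subset n) → 𝒳 Γ' G X → 𝒳 Γ G X) →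
    ∀ (ξ : Vecᴿ R n) → V¹ R Γ G ξ → V¹ R Γ' G ξ
theorem3p14 R G Γ' Γ E-⊆ 𝒳-⊆ ξ (kξ , η , η∈Z , ¬ξ∥η) =
  K-antitone R G Γ' Γ 𝒳-⊆ kξ , η , InZ-antitone R G Γ' Γ 𝒳-⊆ E-⊆ η∈Z , ¬ξ∥η
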